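{- Let $p$ be a prime, let $w_1,w_2,w_3$ be positive integers, let $y_1,y_2,y_3\in\mathbb{Z}_p$, and let $n\ge 0$ be an integer. Then the following six expressions are all equal: \begin{align*} &\sum_{k+\ell+m=n}\binom{n}{k,\ell,m}B_{k}(w_{1}y_{1})B_{\ell}(w_{2}y_{2})B_{m}(w_{3}y_{3})\,w_{1}^{\ell+m}w_{2}^{k+m}w_{3}^{k+\ell}\\ &=\sum_{k+\ell+m=n}\binom{n}{k,\ell,m}B_{k}(w_{1}y_{1})B_{\ell}(w_{3}y_{2})B_{m}(w_{2}y_{3})\,w_{1}^{\ell+m}w_{3}^{k+m}w_{2}^{k+\ell}\\ &=\sum_{k+\ell+m=n}\binom{n}{k,\ell,m}B_{k}(w_{2}y_{1})B_{\ell}(w_{1}y_{2})B_{m}(w_{3}y_{3})\,w_{2}^{\ell+m}w_{1}^{k+m}w_{3}^{k+\ell}\\ &=\sum_{k+\ell+m=n}\binom{n}{k,\ell,m}B_{k}(w_{2}y_{1})B_{\ell}(w_{3}y_{2})B_{m}(w_{1}y_{3})\,w_{2}^{\ell+m}w_{3}^{k+m}w_{1}^{k+\ell}\\ &=\sum_{k+\ell+m=n}\binom{n}{k,\ell,m}B_{k}(w_{3}y_{1})B_{\ell}(w_{1}y_{2})B_{m}(w_{2}y_{3})\,w_{3}^{\ell+m}w_{1}^{k+m}w_{2}^{k+\ell}\\ &=\sum_{k+\ell+m=n}\binom{n}{k,\ell,m}B_{k}(w_{3}y_{1})B_{\ell}(w_{2}y_{2})B_{m}(w_{1}y_{3})\,w_{3}^{\ell+m}w_{2}^{k+m}w_{1}^{k+\ell}.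 \end{align*}
   Context: $\mathbb{Z}_p$ denotes the ring of $p$-adic integers. The Bernoulli polynomials $B_n(x)$ are defined by $\frac{t}{e^t-1}e^{xt}=\sum_{n\ge0}B_n(x)\frac{t^n}{n!}$. Sums $\sum_{k+\ell+m=n}$ run over all nonnegative integers $k,\ell,m$ with $k+\ell+m=n$, and $\binom{n}{k,\ell,m}=\frac{n!}{k!\,\ell!\,m!}$. -}

module Defs where

open import Level using (Level)
open import Data.Bool using (if_then_else_)
open import Data.Nat as ℕ using (ℕ; zero; suc; _∸_; _≤ᵇ_)
open import Data.Nat.Combinatorics using (_C_)
open import Data.List using (List; foldr; map; upTo)
open import Data.Integer using (+_)
open import Data.Rational as ℚ using (ℚ; 0ℚ; 1ℚ)
import Data.Rational.Properties as ℚP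
open import Algebra.Bundles using (CommutativeRing)
open import Algebra.Morphism.Structures using (module RingMorphisms)

ℕ→ℚ : ℕ → ℚ
ℕ→ℚ k = + k ℚ./ 1

sumℚ : ℕ → (ℕ → ℚ) → ℚ
sumℚ n f = foldr ℚ._+_ 0ℚ (map f (upTo (suc n)))

-- bernUpTo n k = B_k for k ≤ n (Bernoulli numbers, convention B_1 = -1/2,
-- i.e. t/(e^t-1) = Σ B_n t^n/n!), via the standard recurrence
-- B_{m} = -1/(m+1) Σ_{k<m} binom(m+1,k) B_k  (m ≥ 1), B_0 = 1,
-- which is equivalent to the generating-function definition.
bernUpTo : ℕ → ℕ → ℚ
bernUpTo zero    _ = 1ℚ
bernUpTo (suc n) k =
  if k ≤ᵇ n then bernUpTo n k
  else ℚ.- ((+ 1 ℚ./ suc (suc n)) ℚ.* sumℚ n (λ j → ℕ→ℚ (suc (suc n) C j) ℚ.* bernUpTo n j))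

bernoulli : ℕ → ℚ
bernoulli n = bernUpTo n n

IsℚAlgebraMap : ∀ {c ℓ} (R : CommutativeRing c ℓ) → (ℚ → CommutativeRing.Carrier R) → Set ℓ
IsℚAlgebraMap R ι = RingMorphisms.IsRingHomomorphism ℚP.+-*-rawRing (CommutativeRing.rawRing R) ι

module _ {c ℓ} (R : CommutativeRing c ℓ) (ι : ℚ → CommutativeRing.Carrier R) where
  open CommutativeRing R

  powR : Carrier → ℕ → Carrier
  powR x zero    = 1#
  powR x (suc k) = x * powR x k

  sumR : ℕ → (ℕ → Carrier) → Carrier
  sumR n f = foldr _+_ 0# (map f (upTo (suc n)))

  natR : ℕ → Carrier
  natR k = ι (ℕ→ℚ k)

  bernPoly : ℕ → Carrier → Carrier
  bernPoly n x = sumR n (λ k → ι (ℕ→ℚ (n C k) ℚ.* bernoulli k) * powR x (n ∸ k))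

  -- multinomial coefficient n!/(k! l! (n-k-l)!) = binom(n,k) binom(n-k,l)
  multinom : ℕ → ℕ → ℕ → ℕ
  multinom n k l = (n C k) ℕ.* ((n ∸ k) C l)

  tripleSum : ℕ → (a b c' y₁ y₂ y₃ : Carrier) → Carrier
  tripleSum n a b c' y₁ y₂ y₃ =
    sumR n (λ k → sumR (n ∸ k) (λ l →
      let m = n ∸ k ∸ l in
      natR (multinom n k l)
        * bernPoly k (a * y₁) * bernPoly l (b * y₂) * bernPoly m (c' * y₃)
        * powR a (l ℕ.+ m) * powR b (k ℕ.+ m) * powR c' (k ℕ.+ l)))

-- With 𝔅(x, t) = Σₖ Bₖ(x) tᵏ/k! = E(t) e^{xt}, where E(t) = t/(eᵗ − 1), the sum with weights a, b, c
-- is n! times the coefficient of tⁿ in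
--   𝔅(a y₁, bc t) 𝔅(b y₂, ac t) 𝔅(c y₃, ab t) = E(bc t) E(ac t) E(ab t) e^{abc (y₁ + y₂ + y₃) t},
-- which is symmetric in a, b, c. Exponential generating functions are handled through their
-- coefficient sequences, multiplied by binomial convolution; nothing specific to the Bernoulli
-- numbers is used.
module Submission where

open import Defs
open import Data.Nat as ℕ using (ℕ; zero; suc; NonZero; _∸_; _≤_; _<_; z≤n; s≤s; _!)
import Data.Nat.Properties as ℕ
open import Data.Nat.Properties using (_!≢0; _!*_!≢0)
open import Data.Nat.Combinatorics using (_C_; nCk≡n!/k![n-k]!; k![n∸k]!∣n!; nCk≡nC[n∸k])
open import Data.Nat.DivMod using (m/n*n≡m)
import Data.Nat.Coprimality as Coprime
open import Data.Nat.Primality using (Prime)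
open import Data.Nat.Solver using (module +-*-Solver)
import Data.Integer as ℤ
open import Data.Integer.Properties using (+◃n≡+n)
open import Data.Rational as ℚ using (ℚ; 1ℚ; mkℚ)
open import Data.Rational.Properties using (normalize-coprime)
open import Data.Product using (_×_; _,_)
open import Data.List using (foldr; map; upTo; applyUpTo)
open import Data.List.Properties using (map-applyUpTo)
open import Function using (_∘_; id)
open import Algebra.Bundles using (CommutativeRing; CommutativeSemiring; CommutativeSemigroup)
open import Algebra.Morphism.Structures using (module RingMorphisms)
import Algebra.Solver.CommutativeMonoid as CommutativeMonoidSolver
import Algebra.Properties.CommutativeSemigroup as CommutativeSemigroupProperties
open import Relation.Binary.PropositionalEquality as ≡ using (_≡_)

nCk*[k!*[n∸k]!]≡n! : ∀ {n k} → k ≤ n → (n C k) ℕ.* (k ! ℕ.* (n ∸ k) !) ≡ n !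
nCk*[k!*[n∸k]!]≡n! {n} {k} k≤n =
  ≡.trans (≡.cong (ℕ._* (k ! ℕ.* (n ∸ k) !)) (nCk≡n!/k![n-k]! k≤n)) (m/n*n≡m (k![n∸k]!∣n! k≤n))
  where instance _ = k !* (n ∸ k) !≢0

[n∸k]∸[i∸k]≡n∸i : ∀ n {k i} → k ≤ i → n ∸ k ∸ (i ∸ k) ≡ n ∸ i
[n∸k]∸[i∸k]≡n∸i n {k} {i} k≤i =
  ≡.trans (ℕ.∸-+-assoc n k (i ∸ k)) (≡.cong (n ∸_) (ℕ.m+[n∸m]≡n k≤i))

nCk*[n∸k]C[i∸k]≡nCi*iCk : ∀ {n k i} → k ≤ i → i ≤ n →
  (n C k) ℕ.* ((n ∸ k) C (i ∸ k)) ≡ (n C i) ℕ.* (i C k)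
nCk*[n∸k]C[i∸k]≡nCi*iCk {n} {k} {i} k≤i i≤n = ℕ.*-cancelʳ-≡ _ _ (x ℕ.* (y ℕ.* z)) (begin
  a ℕ.* b ℕ.* (x ℕ.* (y ℕ.* z))
    ≡⟨ solve 5 (λ a b x y z → a :* b :* (x :* (y :* z)) := a :* (x :* (b :* (y :* z)))) ≡.refl a b x y z ⟩
  a ℕ.* (x ℕ.* (b ℕ.* (y ℕ.* z))) ≡⟨ ≡.cong (λ w → a ℕ.* (x ℕ.* w)) [n∸k]! ⟩
  a ℕ.* (x ℕ.* (n ∸ k) !)       ≡⟨ nCk*[k!*[n∸k]!]≡n! (ℕ.≤-trans k≤i i≤n) ⟩
  n !                           ≡⟨ nCk*[k!*[n∸k]!]≡n! i≤n ⟨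
  c ℕ.* (i ! ℕ.* z)             ≡⟨ ≡.cong (λ w → c ℕ.* (w ℕ.* z)) (nCk*[k!*[n∸k]!]≡n! k≤i) ⟨
  c ℕ.* (d ℕ.* (x ℕ.* y) ℕ.* z)
    ≡⟨ solve 5 (λ c d x y z → c :* (d :* (x :* y) :* z) := c :* d :* (x :* (y :* z))) ≡.refl c d x y z ⟩
  c ℕ.* d ℕ.* (x ℕ.* (y ℕ.* z)) ∎)
  where
  open +-*-Solver
  open ≡.≡-Reasoning
  a = n C k ; b = (n ∸ k) C (i ∸ k) ; c = n C i ; d = i C k
  x = k ! ; y = (i ∸ k) ! ; z = (n ∸ i) !
  instance _ = ℕ.m*n≢0 x (y ℕ.* z) {{k !≢0}} {{(i ∸ k) !* (n ∸ i) !≢0}}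
  [n∸k]! : b ℕ.* (y ℕ.* z) ≡ (n ∸ k) !
  [n∸k]! = ≡.trans (≡.cong (λ w → b ℕ.* (y ℕ.* w !)) (≡.sym ([n∸k]∸[i∸k]≡n∸i n k≤i)))
                   (nCk*[k!*[n∸k]!]≡n! (ℕ.∸-monoˡ-≤ k i≤n))

ℕ→ℚ≡mkℚ : ∀ k → ℕ→ℚ k ≡ mkℚ (ℤ.+ k) 0 (Coprime.sym (Coprime.1-coprimeTo k))
ℕ→ℚ≡mkℚ k = normalize-coprime (Coprime.sym (Coprime.1-coprimeTo k))

ℕ→ℚ-suc : ∀ k → ℕ→ℚ (suc k) ≡ 1ℚ ℚ.+ ℕ→ℚ k
ℕ→ℚ-suc k rewrite ℕ→ℚ≡mkℚ k | ℕ.*-identityʳ k | +◃n≡+n k = ≡.refl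

module FiniteSums {r ℓ} (S : CommutativeSemiring r ℓ) where
  open CommutativeSemiring S
  open import Relation.Binary.Reasoning.Setoid setoid
  open import Algebra.Properties.CommutativeSemigroup +-commutativeSemigroup using (interchange)

  -- Opaque, so that ∑ (suc n) f does not unfold and f can be found by unification.
  opaque
    ∑ : ℕ → (ℕ → Carrier) → Carrier
    ∑ zero    f = 0#
    ∑ (suc m) f = f 0 + ∑ m (f ∘ suc)

    infixr 10 ∑
    syntax ∑ m (λ k → e) = ∑[ k < m ] e

    ∑-cong : ∀ m {f g : ℕ → Carrier} → (∀ k → k < m → f k ≈ g k) → ∑ m f ≈ ∑ m g
    ∑-cong zero    f≈g = refl
    ∑-cong (suc m) f≈g = +-cong (f≈g 0 (s≤s z≤n)) (∑-cong m (λ k k<m → f≈g (suc k) (s≤s k<m)))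

    ∑-distrib-+ : ∀ m (f g : ℕ → Carrier) → ∑[ k < m ] (f k + g k) ≈ ∑ m f + ∑ m g
    ∑-distrib-+ zero    f g = sym (+-identityʳ 0#)
    ∑-distrib-+ (suc m) f g =
      trans (+-congˡ (∑-distrib-+ m (f ∘ suc) (g ∘ suc))) (interchange (f 0) (g 0) _ _)

    *-distribˡ-∑ : ∀ m x (f : ℕ → Carrier) → x * ∑ m f ≈ ∑[ k < m ] (x * f k)
    *-distribˡ-∑ zero    x f = zeroʳ x
    *-distribˡ-∑ (suc m) x f = trans (distribˡ x (f 0) _) (+-congˡ (*-distribˡ-∑ m x (f ∘ suc)))

    *-distribʳ-∑ : ∀ m x (f : ℕ → Carrier) → ∑ m f * x ≈ ∑[ k < m ] (f k * x)
    *-distribʳ-∑ zero    x f = zeroˡ x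
    *-distribʳ-∑ (suc m) x f = trans (distribʳ x (f 0) _) (+-congˡ (*-distribʳ-∑ m x (f ∘ suc)))

    ∑-last : ∀ m (f : ℕ → Carrier) → ∑ (suc m) f ≈ ∑ m f + f m
    ∑-last zero    f = +-comm (f 0) 0#
    ∑-last (suc m) f = trans (+-congˡ (∑-last m (f ∘ suc))) (sym (+-assoc (f 0) _ _))

    ∑-reverse : ∀ m (f : ℕ → Carrier) → ∑ m f ≈ ∑[ k < m ] f (m ∸ suc k)
    ∑-reverse zero    f = refl
    ∑-reverse (suc m) f = begin
      f 0 + ∑ m (f ∘ suc)
        ≈⟨ +-comm _ _ ⟩
      ∑ m (f ∘ suc) + f 0
        ≈⟨ +-cong (∑-reverse m (f ∘ suc)) (reflexive (≡.cong f (≡.sym (ℕ.n∸n≡0 m)))) ⟩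
      ∑[ k < m ] f (suc (m ∸ suc k)) + f (m ∸ m)
        ≈⟨ +-congʳ (∑-cong m λ k k<m → reflexive (≡.cong f (≡.sym (ℕ.+-∸-assoc 1 k<m)))) ⟩
      ∑[ k < m ] f (m ∸ k) + f (m ∸ m)
        ≈⟨ ∑-last m (λ k → f (m ∸ k)) ⟨
      ∑[ k < suc m ] f (suc m ∸ suc k) ∎

    ∑-triangle : ∀ n (F : ℕ → ℕ → Carrier) →
      ∑[ k < suc n ] ∑[ j < suc (n ∸ k) ] F k j ≈ ∑[ i < suc n ] ∑[ k < suc i ] F k (i ∸ k)
    ∑-triangle zero    F = refl
    -- The first and last lines are the two sides unfolded: the left one at k = 0, the right one at
    -- k = 0 inside every inner sum.
    ∑-triangle (suc n) F = begin
      (F 0 0 + ∑[ j < suc n ] F 0 (suc j)) + ∑[ k < suc n ] ∑[ j < suc (n ∸ k) ] F (suc k) j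
        ≈⟨ +-congˡ (∑-triangle n (F ∘ suc)) ⟩
      (F 0 0 + ∑[ j < suc n ] F 0 (suc j)) + ∑[ i < suc n ] ∑[ k < suc i ] F (suc k) (i ∸ k)
        ≈⟨ +-assoc _ _ _ ⟩
      F 0 0 + (∑[ j < suc n ] F 0 (suc j) + ∑[ i < suc n ] ∑[ k < suc i ] F (suc k) (i ∸ k))
        ≈⟨ +-cong (+-identityʳ _) (∑-distrib-+ (suc n) (F 0 ∘ suc) (λ i → ∑[ k < suc i ] F (suc k) (i ∸ k))) ⟨
      (F 0 0 + 0#) + ∑[ i < suc n ] (F 0 (suc i) + ∑[ k < suc i ] F (suc k) (i ∸ k)) ∎

    foldr-upTo≡∑ : ∀ m (f : ℕ → Carrier) → foldr _+_ 0# (map f (upTo m)) ≡ ∑ m f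
    foldr-upTo≡∑ m f = ≡.trans (≡.cong (foldr _+_ 0#) (map-applyUpTo id f m)) (foldr-applyUpTo≡∑ m f)
      where
      foldr-applyUpTo≡∑ : ∀ m (f : ℕ → Carrier) → foldr _+_ 0# (applyUpTo f m) ≡ ∑ m f
      foldr-applyUpTo≡∑ zero    f = ≡.refl
      foldr-applyUpTo≡∑ (suc m) f = ≡.cong (f 0 +_) (foldr-applyUpTo≡∑ m (f ∘ suc))

module BinomialConvolution {r ℓ} (S : CommutativeSemiring r ℓ) where
  open CommutativeSemiring S
  open FiniteSums S
  open import Algebra.Properties.CommutativeSemiring.Exp S public
    using (_^_; ^-congˡ; ^-congʳ; ^-homo-*; ^-distrib-*)
  import Algebra.Properties.Semiring.Mult semiring as Mult
  open import Relation.Binary.Reasoning.Setoid setoid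
  open CommutativeMonoidSolver *-commutativeMonoid using (solve; _⊕_; _⊜_)

  ⌜_⌝ : ℕ → Carrier
  ⌜ m ⌝ = m Mult.× 1#

  ⌜⌝-homo-* : ∀ m n → ⌜ m ℕ.* n ⌝ ≈ ⌜ m ⌝ * ⌜ n ⌝
  ⌜⌝-homo-* = Mult.×1-homo-*

  Seq : Set r
  Seq = ℕ → Carrier

  infix 4 _≋_
  _≋_ : Seq → Seq → Set ℓ
  f ≋ g = ∀ n → f n ≈ g n

  -- (f ⊛ g) n / n! is the coefficient of tⁿ in (Σₖ f k tᵏ/k!) (Σₖ g k tᵏ/k!).
  infixl 7 _⊛_
  _⊛_ : Seq → Seq → Seq
  (f ⊛ g) n = ∑[ k < suc n ] (⌜ n C k ⌝ * (f k * g (n ∸ k)))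

  ⊛-cong : ∀ {f f′ g g′} → f ≋ f′ → g ≋ g′ → f ⊛ g ≋ f′ ⊛ g′
  ⊛-cong f≋f′ g≋g′ n = ∑-cong (suc n) λ k _ → *-congˡ (*-cong (f≋f′ k) (g≋g′ (n ∸ k)))

  ⊛-comm : ∀ f g → f ⊛ g ≋ g ⊛ f
  ⊛-comm f g n = begin
    (f ⊛ g) n
      ≈⟨ ∑-reverse (suc n) _ ⟩
    ∑[ i < suc n ] (⌜ n C (n ∸ i) ⌝ * (f (n ∸ i) * g (n ∸ (n ∸ i))))
      ≈⟨ ∑-cong (suc n) (λ i i<1+n → mirror (ℕ.≤-pred i<1+n)) ⟩
    (g ⊛ f) n ∎
    where
    mirror : ∀ {i} → i ≤ n →
      ⌜ n C (n ∸ i) ⌝ * (f (n ∸ i) * g (n ∸ (n ∸ i))) ≈ ⌜ n C i ⌝ * (g i * f (n ∸ i))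
    mirror i≤n = *-cong (reflexive (≡.cong ⌜_⌝ (≡.sym (nCk≡nC[n∸k] i≤n))))
                        (trans (*-comm _ _) (*-congʳ (reflexive (≡.cong g (ℕ.m∸[m∸n]≡n i≤n)))))

  ⊛-assoc : ∀ f g h → (f ⊛ g) ⊛ h ≋ f ⊛ (g ⊛ h)
  ⊛-assoc f g h n = begin
    ((f ⊛ g) ⊛ h) n
      ≈⟨ ∑-cong (suc n) (λ i _ → expandˡ i) ⟩
    ∑[ i < suc n ] ∑[ k < suc i ] left i k
      ≈⟨ ∑-cong (suc n) (λ i i<1+n → ∑-cong (suc i) λ k k<1+i →
           left≈right (ℕ.≤-pred k<1+i) (ℕ.≤-pred i<1+n)) ⟩
    ∑[ i < suc n ] ∑[ k < suc i ] right k (i ∸ k)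
      ≈⟨ ∑-triangle n right ⟨
    ∑[ k < suc n ] ∑[ j < suc (n ∸ k) ] right k j
      ≈⟨ ∑-cong (suc n) (λ k _ → expandʳ k) ⟨
    (f ⊛ (g ⊛ h)) n ∎
    where
    left : ℕ → ℕ → Carrier
    left i k = ⌜ n C i ⌝ * (⌜ i C k ⌝ * (f k * g (i ∸ k)) * h (n ∸ i))
    right : ℕ → ℕ → Carrier
    right k j = ⌜ n C k ⌝ * (f k * (⌜ (n ∸ k) C j ⌝ * (g j * h (n ∸ k ∸ j))))
    expandˡ : ∀ i → ⌜ n C i ⌝ * ((f ⊛ g) i * h (n ∸ i)) ≈ ∑[ k < suc i ] left i k
    expandˡ i = trans (*-congˡ (*-distribʳ-∑ (suc i) _ _)) (*-distribˡ-∑ (suc i) _ _)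
    expandʳ : ∀ k → ⌜ n C k ⌝ * (f k * (g ⊛ h) (n ∸ k)) ≈ ∑[ j < suc (n ∸ k) ] right k j
    expandʳ k = trans (*-congˡ (*-distribˡ-∑ (suc (n ∸ k)) _ _)) (*-distribˡ-∑ (suc (n ∸ k)) _ _)
    coefficients : ∀ {k i} → k ≤ i → i ≤ n →
      ⌜ n C i ⌝ * ⌜ i C k ⌝ ≈ ⌜ n C k ⌝ * ⌜ (n ∸ k) C (i ∸ k) ⌝
    coefficients {k} {i} k≤i i≤n = begin
      ⌜ n C i ⌝ * ⌜ i C k ⌝                 ≈⟨ ⌜⌝-homo-* (n C i) (i C k) ⟨
      ⌜ (n C i) ℕ.* (i C k) ⌝               ≡⟨ ≡.cong ⌜_⌝ (nCk*[n∸k]C[i∸k]≡nCi*iCk k≤i i≤n) ⟨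
      ⌜ (n C k) ℕ.* ((n ∸ k) C (i ∸ k)) ⌝   ≈⟨ ⌜⌝-homo-* (n C k) ((n ∸ k) C (i ∸ k)) ⟩
      ⌜ n C k ⌝ * ⌜ (n ∸ k) C (i ∸ k) ⌝ ∎
    left≈right : ∀ {k i} → k ≤ i → i ≤ n → left i k ≈ right k (i ∸ k)
    left≈right {k} {i} k≤i i≤n = begin
      ⌜ n C i ⌝ * (⌜ i C k ⌝ * (f k * g (i ∸ k)) * h (n ∸ i))
        ≈⟨ solve 5 (λ a b x y z → (a ⊕ ((b ⊕ (x ⊕ y)) ⊕ z)) ⊜ ((a ⊕ b) ⊕ (x ⊕ (y ⊕ z)))) refl
             ⌜ n C i ⌝ ⌜ i C k ⌝ (f k) (g (i ∸ k)) (h (n ∸ i)) ⟩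
      (⌜ n C i ⌝ * ⌜ i C k ⌝) * (f k * (g (i ∸ k) * h (n ∸ i)))
        ≈⟨ *-congʳ (coefficients k≤i i≤n) ⟩
      (⌜ n C k ⌝ * ⌜ (n ∸ k) C (i ∸ k) ⌝) * (f k * (g (i ∸ k) * h (n ∸ i)))
        ≈⟨ solve 5 (λ a b x y z → ((a ⊕ b) ⊕ (x ⊕ (y ⊕ z))) ⊜ (a ⊕ (x ⊕ (b ⊕ (y ⊕ z))))) refl
             ⌜ n C k ⌝ ⌜ (n ∸ k) C (i ∸ k) ⌝ (f k) (g (i ∸ k)) (h (n ∸ i)) ⟩
      ⌜ n C k ⌝ * (f k * (⌜ (n ∸ k) C (i ∸ k) ⌝ * (g (i ∸ k) * h (n ∸ i))))
        ≡⟨ ≡.cong (λ j → ⌜ n C k ⌝ * (f k * (⌜ (n ∸ k) C (i ∸ k) ⌝ * (g (i ∸ k) * h j))))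
                  ([n∸k]∸[i∸k]≡n∸i n k≤i) ⟨
      right k (i ∸ k) ∎

  ⊛-commutativeSemigroup : CommutativeSemigroup r ℓ
  ⊛-commutativeSemigroup = record
    { _≈_ = _≋_
    ; _∙_ = _⊛_
    ; isCommutativeSemigroup = record
      { isSemigroup = record
        { isMagma = record
          { isEquivalence = record
            { refl  = λ _ → refl
            ; sym   = λ f≋g n → sym (f≋g n)
            ; trans = λ f≋g g≋h n → trans (f≋g n) (g≋h n)
            }
          ; ∙-cong = ⊛-cong
          }
        ; assoc = ⊛-assoc
        }
      ; comm = ⊛-comm
      }
    }

  -- Multiplying the n-th term by sⁿ is the substitution t ↦ s t in the generating function.
  twist : Carrier → Seq → Seq
  twist s f k = s ^ k * f k

  twist-cong : ∀ {s s′ f f′} → s ≈ s′ → f ≋ f′ → twist s f ≋ twist s′ f′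
  twist-cong s≈s′ f≋f′ k = *-cong (^-congˡ k s≈s′) (f≋f′ k)

  powers-cong : ∀ {x x′} → x ≈ x′ → x ^_ ≋ x′ ^_
  powers-cong x≈x′ k = ^-congˡ k x≈x′

  twist-^ : ∀ s x → twist s (x ^_) ≋ (s * x) ^_
  twist-^ s x k = sym (^-distrib-* s x k)

  twist-⊛ : ∀ s f g → twist s (f ⊛ g) ≋ twist s f ⊛ twist s g
  twist-⊛ s f g n = trans (*-distribˡ-∑ (suc n) (s ^ n) _) (∑-cong (suc n) λ k k<1+n → begin
    s ^ n * (⌜ n C k ⌝ * (f k * g (n ∸ k)))
      ≈⟨ *-congʳ (trans (^-congʳ s (≡.sym (ℕ.m+[n∸m]≡n (ℕ.≤-pred k<1+n)))) (^-homo-* s k (n ∸ k))) ⟩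
    s ^ k * s ^ (n ∸ k) * (⌜ n C k ⌝ * (f k * g (n ∸ k)))
      ≈⟨ solve 5 (λ p q a x y → ((p ⊕ q) ⊕ (a ⊕ (x ⊕ y))) ⊜ (a ⊕ ((p ⊕ x) ⊕ (q ⊕ y)))) refl
           (s ^ k) (s ^ (n ∸ k)) ⌜ n C k ⌝ (f k) (g (n ∸ k)) ⟩
    ⌜ n C k ⌝ * (twist s f k * twist s g (n ∸ k)) ∎)

module BernoulliTripleSum {r ℓ} (R : CommutativeRing r ℓ)
  (ι : ℚ → CommutativeRing.Carrier R) (ι-hom : IsℚAlgebraMap R ι) where
  open CommutativeRing R
  open RingMorphisms.IsRingHomomorphism ι-hom using (+-homo; *-homo; 0#-homo; 1#-homo)
  open FiniteSums commutativeSemiring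
  open BinomialConvolution commutativeSemiring
  open CommutativeSemigroupProperties ⊛-commutativeSemigroup using (interchange; x∙yz≈y∙xz; x∙yz≈x∙zy)
  open CommutativeMonoidSolver *-commutativeMonoid using (solve; _⊕_; _⊜_)
  open import Relation.Binary.Reasoning.Setoid setoid

  sumR≡∑ : ∀ n f → sumR R ι n f ≡ ∑ (suc n) f
  sumR≡∑ n = foldr-upTo≡∑ (suc n)

  powR≡^ : ∀ x k → powR R ι x k ≡ x ^ k
  powR≡^ x zero    = ≡.refl
  powR≡^ x (suc k) = ≡.cong (x *_) (powR≡^ x k)

  natR≈⌜⌝ : ∀ k → natR R ι k ≈ ⌜ k ⌝
  natR≈⌜⌝ zero    = 0#-homo
  natR≈⌜⌝ (suc k) = begin
    ι (ℕ→ℚ (suc k))   ≡⟨ ≡.cong ι (ℕ→ℚ-suc k) ⟩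
    ι (1ℚ ℚ.+ ℕ→ℚ k)  ≈⟨ +-homo 1ℚ (ℕ→ℚ k) ⟩
    ι 1ℚ + natR R ι k ≈⟨ +-cong 1#-homo (natR≈⌜⌝ k) ⟩
    1# + ⌜ k ⌝         ∎

  β : Seq
  β k = ι (bernoulli k)

  bernPolys : Carrier → Seq
  bernPolys x n = bernPoly R ι n x

  bernPolys≈β⊛^ : ∀ x → bernPolys x ≋ β ⊛ (x ^_)
  bernPolys≈β⊛^ x n = begin
    bernPoly R ι n x
      ≡⟨ sumR≡∑ n (λ k → ι (ℕ→ℚ (n C k) ℚ.* bernoulli k) * powR R ι x (n ∸ k)) ⟩
    ∑[ k < suc n ] (ι (ℕ→ℚ (n C k) ℚ.* bernoulli k) * powR R ι x (n ∸ k))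
      ≈⟨ ∑-cong (suc n) (λ k _ → *-cong (trans (*-homo _ _) (*-congʳ (natR≈⌜⌝ (n C k))))
                                         (reflexive (powR≡^ x (n ∸ k)))) ⟩
    ∑[ k < suc n ] (⌜ n C k ⌝ * β k * x ^ (n ∸ k))
      ≈⟨ ∑-cong (suc n) (λ k _ → *-assoc _ _ _) ⟩
    (β ⊛ (x ^_)) n ∎

  twist-bernPolys : ∀ s x → twist s (bernPolys x) ≋ twist s β ⊛ (s * x) ^_
  twist-bernPolys s x n = begin
    twist s (bernPolys x) n         ≈⟨ twist-cong refl (bernPolys≈β⊛^ x) n ⟩
    twist s (β ⊛ (x ^_)) n          ≈⟨ twist-⊛ s β (x ^_) n ⟩
    (twist s β ⊛ twist s (x ^_)) n  ≈⟨ ⊛-cong (λ _ → refl) (twist-^ s x) n ⟩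
    (twist s β ⊛ (s * x) ^_) n      ∎

  module _ (n : ℕ) (a b c y₁ y₂ y₃ : Carrier) where
    private
      F₁ F₂ F₃ : Seq
      F₁ = twist (b * c) (bernPolys (a * y₁))
      F₂ = twist (a * c) (bernPolys (b * y₂))
      F₃ = twist (a * b) (bernPolys (c * y₃))

      summand : ℕ → ℕ → Carrier
      summand k l = natR R ι (multinom R ι n k l)
        * bernPoly R ι k (a * y₁) * bernPoly R ι l (b * y₂) * bernPoly R ι (n ∸ k ∸ l) (c * y₃)
        * powR R ι a (l ℕ.+ (n ∸ k ∸ l)) * powR R ι b (k ℕ.+ (n ∸ k ∸ l)) * powR R ι c (k ℕ.+ l)

      summand≈ : ∀ k l →
        summand k l ≈ ⌜ n C k ⌝ * (F₁ k * (⌜ (n ∸ k) C l ⌝ * (F₂ l * F₃ (n ∸ k ∸ l))))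
      summand≈ k l = begin
        summand k l
          ≈⟨ *-cong (*-cong (*-cong (*-congʳ (*-congʳ (*-congʳ coefficient))) (power a l m))
                            (power b k m)) (power c k l) ⟩
        N₁ * N₂ * P₁ * P₂ * P₃ * (a ^ l * a ^ m) * (b ^ k * b ^ m) * (c ^ k * c ^ l)
          ≈⟨ solve 11 (λ N₁ N₂ P₁ P₂ P₃ aˡ aᵐ bᵏ bᵐ cᵏ cˡ →
               (((((((N₁ ⊕ N₂) ⊕ P₁) ⊕ P₂) ⊕ P₃) ⊕ (aˡ ⊕ aᵐ)) ⊕ (bᵏ ⊕ bᵐ)) ⊕ (cᵏ ⊕ cˡ)) ⊜
               (N₁ ⊕ (((bᵏ ⊕ cᵏ) ⊕ P₁) ⊕ (N₂ ⊕ (((aˡ ⊕ cˡ) ⊕ P₂) ⊕ ((aᵐ ⊕ bᵐ) ⊕ P₃))))))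
               refl N₁ N₂ P₁ P₂ P₃ (a ^ l) (a ^ m) (b ^ k) (b ^ m) (c ^ k) (c ^ l) ⟩
        N₁ * ((b ^ k * c ^ k) * P₁ * (N₂ * ((a ^ l * c ^ l) * P₂ * ((a ^ m * b ^ m) * P₃))))
          ≈⟨ *-congˡ (*-cong (*-congʳ (^-distrib-* b c k))
                 (*-congˡ (*-cong (*-congʳ (^-distrib-* a c l)) (*-congʳ (^-distrib-* a b m))))) ⟨
        ⌜ n C k ⌝ * (F₁ k * (⌜ (n ∸ k) C l ⌝ * (F₂ l * F₃ m))) ∎
        where
        m = n ∸ k ∸ l
        N₁ = ⌜ n C k ⌝ ; N₂ = ⌜ (n ∸ k) C l ⌝
        P₁ = bernPoly R ι k (a * y₁) ; P₂ = bernPoly R ι l (b * y₂) ; P₃ = bernPoly R ι m (c * y₃)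
        coefficient : natR R ι (multinom R ι n k l) ≈ N₁ * N₂
        coefficient = trans (natR≈⌜⌝ (multinom R ι n k l)) (⌜⌝-homo-* (n C k) ((n ∸ k) C l))
        power : ∀ x i j → powR R ι x (i ℕ.+ j) ≈ x ^ i * x ^ j
        power x i j = trans (reflexive (powR≡^ x (i ℕ.+ j))) (^-homo-* x i j)

    tripleSum≈⊛ : tripleSum R ι n a b c y₁ y₂ y₃ ≈ (F₁ ⊛ (F₂ ⊛ F₃)) n
    tripleSum≈⊛ = begin
      tripleSum R ι n a b c y₁ y₂ y₃
        ≡⟨ sumR≡∑ n (λ k → sumR R ι (n ∸ k) (summand k)) ⟩
      ∑[ k < suc n ] sumR R ι (n ∸ k) (summand k)
        ≈⟨ ∑-cong (suc n) (λ k _ → row k) ⟩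
      (F₁ ⊛ (F₂ ⊛ F₃)) n ∎
      where
      row : ∀ k → sumR R ι (n ∸ k) (summand k) ≈ ⌜ n C k ⌝ * (F₁ k * (F₂ ⊛ F₃) (n ∸ k))
      row k = begin
        sumR R ι (n ∸ k) (summand k)
          ≡⟨ sumR≡∑ (n ∸ k) (summand k) ⟩
        ∑[ l < suc (n ∸ k) ] summand k l
          ≈⟨ ∑-cong (suc (n ∸ k)) (λ l _ → summand≈ k l) ⟩
        ∑[ l < suc (n ∸ k) ] (⌜ n C k ⌝ * (F₁ k * (⌜ (n ∸ k) C l ⌝ * (F₂ l * F₃ (n ∸ k ∸ l)))))
          ≈⟨ trans (*-congˡ (*-distribˡ-∑ (suc (n ∸ k)) _ _)) (*-distribˡ-∑ (suc (n ∸ k)) _ _) ⟨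
        ⌜ n C k ⌝ * (F₁ k * (F₂ ⊛ F₃) (n ∸ k)) ∎

  module _ (y₁ y₂ y₃ : Carrier) where
    βFactor : (u v w : Carrier) → Seq
    βFactor u v w = twist u β ⊛ (twist v β ⊛ twist w β)

    powerFactor : (t : Carrier) → Seq
    powerFactor t = (t * y₁) ^_ ⊛ ((t * y₂) ^_ ⊛ (t * y₃) ^_)

    symmetricTripleSum : (u v w t : Carrier) → Seq
    symmetricTripleSum u v w t = βFactor u v w ⊛ powerFactor t

    symmetricTripleSum-cong : ∀ {u u′ v v′ w w′ t t′} → u ≈ u′ → v ≈ v′ → w ≈ w′ → t ≈ t′ →
      symmetricTripleSum u v w t ≋ symmetricTripleSum u′ v′ w′ t′
    symmetricTripleSum-cong {t = t} {t′} u≈u′ v≈v′ w≈w′ t≈t′ =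
      ⊛-cong (⊛-cong (twistβ u≈u′) (⊛-cong (twistβ v≈v′) (twistβ w≈w′)))
             (⊛-cong (powersOf y₁) (⊛-cong (powersOf y₂) (powersOf y₃)))
      where
      twistβ : ∀ {s s′} → s ≈ s′ → twist s β ≋ twist s′ β
      twistβ s≈s′ = twist-cong s≈s′ (λ _ → refl)
      powersOf : ∀ y → (t * y) ^_ ≋ (t′ * y) ^_
      powersOf y = powers-cong (*-congʳ t≈t′)

    symmetricTripleSum-swap₁₂ : ∀ u v w t → symmetricTripleSum u v w t ≋ symmetricTripleSum v u w t
    symmetricTripleSum-swap₁₂ u v w t =
      ⊛-cong {g = powerFactor t} (x∙yz≈y∙xz (twist u β) (twist v β) (twist w β)) (λ _ → refl)

    symmetricTripleSum-swap₂₃ : ∀ u v w t → symmetricTripleSum u v w t ≋ symmetricTripleSum u w v t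
    symmetricTripleSum-swap₂₃ u v w t =
      ⊛-cong {g = powerFactor t} (x∙yz≈x∙zy (twist u β) (twist v β) (twist w β)) (λ _ → refl)

    tripleSum≈symmetricTripleSum : ∀ n a b c →
      tripleSum R ι n a b c y₁ y₂ y₃ ≈ symmetricTripleSum (b * c) (a * c) (a * b) (a * b * c) n
    tripleSum≈symmetricTripleSum n a b c = begin
      tripleSum R ι n a b c y₁ y₂ y₃
        ≈⟨ tripleSum≈⊛ n a b c y₁ y₂ y₃ ⟩
      (F₁ ⊛ (F₂ ⊛ F₃)) n
        ≈⟨ ⊛-cong (twist-bernPolys (b * c) (a * y₁))
                  (⊛-cong (twist-bernPolys (a * c) (b * y₂)) (twist-bernPolys (a * b) (c * y₃))) n ⟩
      ((A₁ ⊛ Q₁) ⊛ ((A₂ ⊛ Q₂) ⊛ (A₃ ⊛ Q₃))) n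
        ≈⟨ ⊛-cong {A₁ ⊛ Q₁} (λ _ → refl) (interchange A₂ Q₂ A₃ Q₃) n ⟩
      ((A₁ ⊛ Q₁) ⊛ ((A₂ ⊛ A₃) ⊛ (Q₂ ⊛ Q₃))) n
        ≈⟨ interchange A₁ Q₁ (A₂ ⊛ A₃) (Q₂ ⊛ Q₃) n ⟩
      ((A₁ ⊛ (A₂ ⊛ A₃)) ⊛ (Q₁ ⊛ (Q₂ ⊛ Q₃))) n
        ≈⟨ ⊛-cong {A₁ ⊛ (A₂ ⊛ A₃)} (λ _ → refl)
                  (⊛-cong (powers-cong e₁) (⊛-cong (powers-cong e₂) (powers-cong e₃))) n ⟩
      symmetricTripleSum (b * c) (a * c) (a * b) (a * b * c) n ∎
      where
      F₁ = twist (b * c) (bernPolys (a * y₁))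
      F₂ = twist (a * c) (bernPolys (b * y₂))
      F₃ = twist (a * b) (bernPolys (c * y₃))
      A₁ = twist (b * c) β ; A₂ = twist (a * c) β ; A₃ = twist (a * b) β
      Q₁ = (b * c * (a * y₁)) ^_ ; Q₂ = (a * c * (b * y₂)) ^_ ; Q₃ = (a * b * (c * y₃)) ^_
      e₁ : b * c * (a * y₁) ≈ a * b * c * y₁
      e₁ = solve 4 (λ a b c y → ((b ⊕ c) ⊕ (a ⊕ y)) ⊜ (((a ⊕ b) ⊕ c) ⊕ y)) refl a b c y₁
      e₂ : a * c * (b * y₂) ≈ a * b * c * y₂
      e₂ = solve 4 (λ a b c y → ((a ⊕ c) ⊕ (b ⊕ y)) ⊜ (((a ⊕ b) ⊕ c) ⊕ y)) refl a b c y₂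
      e₃ : a * b * (c * y₃) ≈ a * b * c * y₃
      e₃ = sym (*-assoc (a * b) c y₃)

    tripleSum-swap₁₂ : ∀ n a b c → tripleSum R ι n a b c y₁ y₂ y₃ ≈ tripleSum R ι n b a c y₁ y₂ y₃
    tripleSum-swap₁₂ n a b c = begin
      tripleSum R ι n a b c y₁ y₂ y₃
        ≈⟨ tripleSum≈symmetricTripleSum n a b c ⟩
      symmetricTripleSum (b * c) (a * c) (a * b) (a * b * c) n
        ≈⟨ symmetricTripleSum-swap₁₂ (b * c) (a * c) (a * b) (a * b * c) n ⟩
      symmetricTripleSum (a * c) (b * c) (a * b) (a * b * c) n
        ≈⟨ symmetricTripleSum-cong refl refl (*-comm a b) (*-congʳ (*-comm a b)) n ⟩
      symmetricTripleSum (a * c) (b * c) (b * a) (b * a * c) n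
        ≈⟨ tripleSum≈symmetricTripleSum n b a c ⟨
      tripleSum R ι n b a c y₁ y₂ y₃ ∎

    tripleSum-swap₂₃ : ∀ n a b c → tripleSum R ι n a b c y₁ y₂ y₃ ≈ tripleSum R ι n a c b y₁ y₂ y₃
    tripleSum-swap₂₃ n a b c = begin
      tripleSum R ι n a b c y₁ y₂ y₃
        ≈⟨ tripleSum≈symmetricTripleSum n a b c ⟩
      symmetricTripleSum (b * c) (a * c) (a * b) (a * b * c) n
        ≈⟨ symmetricTripleSum-swap₂₃ (b * c) (a * c) (a * b) (a * b * c) n ⟩
      symmetricTripleSum (b * c) (a * b) (a * c) (a * b * c) n
        ≈⟨ symmetricTripleSum-cong (*-comm b c) refl refl
             (solve 3 (λ a b c → ((a ⊕ b) ⊕ c) ⊜ ((a ⊕ c) ⊕ b)) refl a b c) n ⟩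
      symmetricTripleSum (c * b) (a * b) (a * c) (a * c * b) n
        ≈⟨ tripleSum≈symmetricTripleSum n a c b ⟨
      tripleSum R ι n a c b y₁ y₂ y₃ ∎

theorem1 : ∀ {c ℓ} (p : ℕ) → Prime p
    → (R : CommutativeRing c ℓ) (ι : ℚ → CommutativeRing.Carrier R) → IsℚAlgebraMap R ι
    → (w₁ w₂ w₃ : ℕ) → NonZero w₁ → NonZero w₂ → NonZero w₃
    → (y₁ y₂ y₃ : CommutativeRing.Carrier R) (n : ℕ)
    → let open CommutativeRing R
          W₁ = natR R ι w₁
          W₂ = natR R ι w₂
          W₃ = natR R ι w₃
          S = λ a b c' → tripleSum R ι n a b c' y₁ y₂ y₃
      in (S W₁ W₂ W₃ ≈ S W₁ W₃ W₂)
         × (S W₁ W₃ W₂ ≈ S W₂ W₁ W₃)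
         × (S W₂ W₁ W₃ ≈ S W₂ W₃ W₁)
         × (S W₂ W₃ W₁ ≈ S W₃ W₁ W₂)
         × (S W₃ W₁ W₂ ≈ S W₃ W₂ W₁)
theorem1 _ _ R ι ι-hom w₁ w₂ w₃ _ _ _ y₁ y₂ y₃ n =
  swap₂₃ W₁ W₂ W₃ ,
  trans (sym (swap₂₃ W₁ W₂ W₃)) (swap₁₂ W₁ W₂ W₃) ,
  swap₂₃ W₂ W₁ W₃ ,
  trans (swap₁₂ W₂ W₃ W₁) (swap₂₃ W₃ W₂ W₁) ,
  swap₂₃ W₃ W₁ W₂
  where
  open CommutativeRing R using (sym; trans)
  open BernoulliTripleSum R ι ι-hom using (tripleSum-swap₁₂; tripleSum-swap₂₃)
  W₁ = natR R ι w₁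
  W₂ = natR R ι w₂
  W₃ = natR R ι w₃
  swap₁₂ = tripleSum-swap₁₂ y₁ y₂ y₃ n
  swap₂₃ = tripleSum-swap₂₃ y₁ y₂ y₃ n
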